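{- For $1\le i\le n-1$ and a word $a_1\dots a_n\in\mathbb{Z}_{\ge0}^n$, define $$s_i\cdot(a_1\dots a_ia_{i+1}\dots a_n)=\begin{cases}a_1\dots a_{i+1}\,(a_i-1)\dots a_n&\text{if }a_i>a_{i+1},\\ a_1\dots(a_{i+1}+1)\,a_i\dots a_n&\text{if }a_i\le a_{i+1},\end{cases}$$ where only positions $i,i+1$ change. Then this rule extends to a free action of the symmetric group $\mathfrak{S}_n$ on $\mathbb{Z}_{\ge0}^n$ (in which the adjacent transposition $s_i=(i,i+1)$ acts by the rule above). Furthermore, every $\mathfrak{S}_n$-orbit in $\mathbb{Z}_{\ge0}^n$ under this action contains a unique strictly decreasing word. -}

module Defs where

open import Data.Nat using (ℕ; zero; suc; _+_; _∸_; _<_; _≤_; _<ᵇ_; s≤s)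
open import Data.Nat.Properties using (<-trans; n<1+n)
open import Data.Bool using (if_then_else_)
open import Data.Vec using (Vec; []; _∷_)
open import Data.Fin using (Fin; fromℕ<)
open import Data.Fin.Permutation using (Permutation′; transpose)

Word : ℕ → Set
Word n = Vec ℕ n

-- The elementary move s_i on words, with positions indexed from 0:
-- step i acts on the (0-based) positions i and i+1, i.e. the paper's
-- positions i+1, i+2.  If a > b (a at position i, b at i+1) it gives
-- b (a-1); if a ≤ b it gives (b+1) a.
step : {n : ℕ} → ℕ → Word n → Word n
step zero (a ∷ b ∷ w) = if b <ᵇ a then b ∷ (a ∸ 1) ∷ w else suc b ∷ a ∷ w
step zero w = w
step (suc i) (a ∷ w) = a ∷ step i w
step (suc i) [] = []

adjacent : {n : ℕ} (i : ℕ) → suc i < n → Permutation′ n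
adjacent i p = transpose (fromℕ< (<-trans (n<1+n i) p)) (fromℕ< p)

data StrictlyDecreasing : {n : ℕ} → Word n → Set where
  sd-[] : StrictlyDecreasing []
  sd-[x] : {a : ℕ} → StrictlyDecreasing (a ∷ [])
  sd-∷ : {n a b : ℕ} {w : Word n} → b < a → StrictlyDecreasing (b ∷ w) → StrictlyDecreasing (a ∷ b ∷ w)

module Submission where

-- The moves s_i are conjugate to plain transpositions of entries.
-- Encode a word a₁…aₙ as x₁…xₙ, where xₖ is the aₖ-th natural number (counting
-- from 0) not among x₁…xₖ₋₁; decode by replacing xₖ with its rank among the
-- numbers not among x₁…xₖ₋₁.  This is a bijection between words and vectors
-- with pairwise distinct entries, and it turns s_i into the swap of the entries
-- at positions i, i+1 (encode-step).  Transporting the action of 𝔖ₙ by moving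
-- entries gives the required action; it is free because the encoded entries
-- are distinct.  Decoding preserves and reflects strict decrease, so strictly
-- decreasing words in an orbit correspond to strictly decreasing
-- rearrangements of one vector with distinct entries: there is exactly one.

open import Data.Bool using (true; false; if_then_else_)
open import Data.Fin using (Fin; zero; suc; toℕ; fromℕ<; inject₁)
import Data.Fin.Properties as Fin
open import Data.Fin.Permutation
  using (Permutation′; _⟨$⟩ʳ_; _⟨$⟩ˡ_; inverseʳ; inverseˡ; id; flip; _∘ₚ_; _≈_;
         transpose; lift₀; lift₀-transpose)
open import Data.List using (List; []; _∷_)
open import Data.List.Relation.Unary.All using (All; []; _∷_)
import Data.List.Relation.Unary.All as All
open import Data.List.Relation.Unary.AllPairs using ([]; _∷_)
open import Data.List.Relation.Unary.Unique.Propositional using (Unique)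
open import Data.Nat using (ℕ; zero; suc; pred; _<_; _≤_; _<?_; _≤?_; _<ᵇ_; s≤s; z≤n)
open import Data.Nat.Properties
  using (<-trans; ≤-trans; ≤-<-trans; ≤-refl; ≤-reflexive; ≤-antisym; <-irrefl; <-cmp;
         n<1+n; <⇒≤; <⇒≤pred; ≮⇒≥; ≰⇒>; <⇒≱; <⇒≯; ≤⇒≯; <⇒≢; >⇒≢; ≤∧≢⇒<;
         m≤n⇒m<n∨m≡n; <ᵇ-reflects-<)
open import Data.Product using (Σ; Σ-syntax; _×_; _,_; proj₁; proj₂)
open import Data.Sum using (inj₁; inj₂)
open import Data.Vec using (Vec; []; _∷_; lookup; tabulate; tail)
open import Data.Vec.Properties using (lookup∘tabulate; tabulate∘lookup; tabulate-cong)
open import Function using (_∘_)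
open import Function.Definitions using (Injective)
open import Relation.Binary.Definitions using (tri<; tri≈; tri>)
open import Relation.Binary.PropositionalEquality
open import Relation.Nullary using (yes; no; ¬_; contradiction)
open import Relation.Nullary.Reflects using (ofʸ; ofⁿ)
open ≡-Reasoning

open import Defs

private
  variable
    A : Set
    a b c m n x y : ℕ
    Q : List ℕ
    v : Vec ℕ n

module Increasing (f : ℕ → ℕ) (f-step : ∀ n → f n < f (suc n)) where

  increasing : m < n → f m < f n
  increasing {m} {suc n} (s≤s m≤n) with m≤n⇒m<n∨m≡n m≤n
  ... | inj₁ m<n  = <-trans (increasing m<n) (f-step n)
  ... | inj₂ refl = f-step n

  monotone : m ≤ n → f m ≤ f n
  monotone m≤n with m≤n⇒m<n∨m≡n m≤n
  ... | inj₁ m<n  = <⇒≤ (increasing m<n)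
  ... | inj₂ refl = ≤-refl

  reflects-< : f m < f n → m < n
  reflects-< {m} {n} fm<fn with m <? n
  ... | yes m<n = m<n
  ... | no  m≮n = contradiction (monotone (≮⇒≥ m≮n)) (<⇒≱ fm<fn)

if-< : {u v : A} → m < n → (if m <ᵇ n then u else v) ≡ u
if-< {m = m} {n = n} m<n with m <ᵇ n | <ᵇ-reflects-< m n
... | true  | _        = refl
... | false | ofⁿ m≮n = contradiction m<n m≮n

if-≮ : {u v : A} → ¬ m < n → (if m <ᵇ n then u else v) ≡ v
if-≮ {m = m} {n = n} m≮n with m <ᵇ n | <ᵇ-reflects-< m n
... | true  | ofʸ m<n = contradiction m<n m≮n
... | false | _       = refl

pick : ℕ → ℕ → ℕ → ℕ
pick y u v = if u <ᵇ y then u else v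

≮-upward : ∀ {t} → m < n → ¬ m < t → ¬ n < t
≮-upward m<n m≮t n<t = m≮t (<-trans m<n n<t)

-- Two thresholds applied to increasing candidates z₀ < z₁ (< z₂) give the same
-- result in either order; this makes unrank independent of the order of Q.
pick-comm : ∀ x y {z₀ z₁} z₂ → z₀ < z₁ →
  pick x (pick y z₀ z₁) (pick y z₁ z₂) ≡ pick y (pick x z₀ z₁) (pick x z₁ z₂)
pick-comm x y {z₀} {z₁} z₂ z₀<z₁ with z₀ <? y | z₀ <? x
... | yes z₀<y | yes z₀<x = begin
  pick x (pick y z₀ z₁) (pick y z₁ z₂) ≡⟨ cong (λ u → pick x u _) (if-< z₀<y) ⟩
  pick x z₀ (pick y z₁ z₂)             ≡⟨ if-< z₀<x ⟩
  z₀                                   ≡⟨ sym (if-< z₀<y) ⟩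
  pick y z₀ (pick x z₁ z₂)             ≡⟨ cong (λ u → pick y u _) (sym (if-< z₀<x)) ⟩
  pick y (pick x z₀ z₁) (pick x z₁ z₂) ∎
... | yes z₀<y | no z₀≮x = begin
  pick x (pick y z₀ z₁) (pick y z₁ z₂) ≡⟨ cong (λ u → pick x u _) (if-< z₀<y) ⟩
  pick x z₀ (pick y z₁ z₂)             ≡⟨ if-≮ z₀≮x ⟩
  pick y z₁ z₂                         ≡⟨ cong (pick y z₁) (sym (if-≮ (≮-upward z₀<z₁ z₀≮x))) ⟩
  pick y z₁ (pick x z₁ z₂)             ≡⟨ cong (λ u → pick y u _) (sym (if-≮ z₀≮x)) ⟩
  pick y (pick x z₀ z₁) (pick x z₁ z₂) ∎
... | no z₀≮y | yes z₀<x = begin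
  pick x (pick y z₀ z₁) (pick y z₁ z₂) ≡⟨ cong (λ u → pick x u _) (if-≮ z₀≮y) ⟩
  pick x z₁ (pick y z₁ z₂)             ≡⟨ cong (pick x z₁) (if-≮ (≮-upward z₀<z₁ z₀≮y)) ⟩
  pick x z₁ z₂                         ≡⟨ sym (if-≮ z₀≮y) ⟩
  pick y z₀ (pick x z₁ z₂)             ≡⟨ cong (λ u → pick y u _) (sym (if-< z₀<x)) ⟩
  pick y (pick x z₀ z₁) (pick x z₁ z₂) ∎
... | no z₀≮y | no z₀≮x = begin
  pick x (pick y z₀ z₁) (pick y z₁ z₂) ≡⟨ cong (λ u → pick x u _) (if-≮ z₀≮y) ⟩
  pick x z₁ (pick y z₁ z₂)             ≡⟨ if-≮ (≮-upward z₀<z₁ z₀≮x) ⟩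
  pick y z₁ z₂                         ≡⟨ if-≮ (≮-upward z₀<z₁ z₀≮y) ⟩
  z₂                                   ≡⟨ sym (if-≮ (≮-upward z₀<z₁ z₀≮x)) ⟩
  pick x z₁ z₂                         ≡⟨ sym (if-≮ (≮-upward z₀<z₁ z₀≮y)) ⟩
  pick y z₁ (pick x z₁ z₂)             ≡⟨ cong (λ u → pick y u _) (sym (if-≮ z₀≮x)) ⟩
  pick y (pick x z₀ z₁) (pick x z₁ z₂) ∎

_∉_ : ℕ → List ℕ → Set
x ∉ Q = All (x ≢_) Q

-- unrank Q a is the a-th number (counting from 0) outside Q, when Q has no
-- repetitions: each y ∈ Q pushes the candidates at or above y up by one.
unrank : List ℕ → ℕ → ℕ
unrank []      a = a
unrank (y ∷ Q) a = pick y (unrank Q a) (unrank Q (suc a))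

-- rank Q x is x minus the number of elements of Q below x; for x ∉ Q it is
-- the position of x in the increasing enumeration of ℕ ∖ Q.
rank : List ℕ → ℕ → ℕ
rank []      x = x
rank (y ∷ Q) x = if y <ᵇ x then pred (rank Q x) else rank Q x

unrank-below : ∀ Q → unrank Q a < y → unrank (y ∷ Q) a ≡ unrank Q a
unrank-below Q = if-<

unrank-above : ∀ Q → ¬ unrank Q a < y → unrank (y ∷ Q) a ≡ unrank Q (suc a)
unrank-above Q = if-≮

rank-above : ∀ Q → y < x → rank (y ∷ Q) x ≡ pred (rank Q x)
rank-above Q = if-<

rank-below : ∀ Q → ¬ y < x → rank (y ∷ Q) x ≡ rank Q x
rank-below Q = if-≮

unrank-step : ∀ Q a → unrank Q a < unrank Q (suc a)
unrank-step []      a = n<1+n a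
unrank-step (y ∷ Q) a with unrank Q a <? y | unrank Q (suc a) <? y
... | yes z₀<y | yes z₁<y =
  subst₂ _<_ (sym (unrank-below Q z₀<y)) (sym (unrank-below Q z₁<y)) (unrank-step Q a)
... | yes z₀<y | no z₁≮y  =
  subst₂ _<_ (sym (unrank-below Q z₀<y)) (sym (unrank-above Q z₁≮y))
    (<-trans (unrank-step Q a) (unrank-step Q (suc a)))
... | no z₀≮y  | yes z₁<y = contradiction (<-trans (unrank-step Q a) z₁<y) z₀≮y
... | no z₀≮y  | no z₁≮y  =
  subst₂ _<_ (sym (unrank-above Q z₀≮y)) (sym (unrank-above Q z₁≮y)) (unrank-step Q (suc a))

unrank-increasing : ∀ Q → a < b → unrank Q a < unrank Q b
unrank-increasing Q = Increasing.increasing (unrank Q) (unrank-step Q)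

unrank-monotone : ∀ Q → a ≤ b → unrank Q a ≤ unrank Q b
unrank-monotone Q = Increasing.monotone (unrank Q) (unrank-step Q)

unrank-reflects-< : ∀ Q → unrank Q a < unrank Q b → a < b
unrank-reflects-< Q = Increasing.reflects-< (unrank Q) (unrank-step Q)

unrank-∉ : ∀ Q a → unrank Q a ∉ Q
unrank-∉ []      a = []
unrank-∉ (y ∷ Q) a with unrank Q a <? y
... | yes z₀<y = subst (_∉ (y ∷ Q)) (sym (unrank-below Q z₀<y)) (<⇒≢ z₀<y ∷ unrank-∉ Q a)
... | no z₀≮y  = subst (_∉ (y ∷ Q)) (sym (unrank-above Q z₀≮y))
  (>⇒≢ (≤-<-trans (≮⇒≥ z₀≮y) (unrank-step Q a)) ∷ unrank-∉ Q (suc a))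

rank-unrank : ∀ Q a → rank Q (unrank Q a) ≡ a
rank-unrank []      a = refl
rank-unrank (y ∷ Q) a with unrank Q a <? y
... | yes z₀<y = begin
  rank (y ∷ Q) (unrank (y ∷ Q) a) ≡⟨ cong (rank (y ∷ Q)) (unrank-below Q z₀<y) ⟩
  rank (y ∷ Q) (unrank Q a)       ≡⟨ rank-below Q (<⇒≯ z₀<y) ⟩
  rank Q (unrank Q a)             ≡⟨ rank-unrank Q a ⟩
  a                               ∎
... | no z₀≮y = begin
  rank (y ∷ Q) (unrank (y ∷ Q) a)    ≡⟨ cong (rank (y ∷ Q)) (unrank-above Q z₀≮y) ⟩
  rank (y ∷ Q) (unrank Q (suc a))    ≡⟨ rank-above Q (≤-<-trans (≮⇒≥ z₀≮y) (unrank-step Q a)) ⟩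
  pred (rank Q (unrank Q (suc a)))   ≡⟨ cong pred (rank-unrank Q (suc a)) ⟩
  a                                  ∎

unrank-insert-below : ∀ Q → b < c → unrank (unrank Q b ∷ Q) (pred c) ≡ unrank Q c
unrank-insert-below {c = suc c} Q (s≤s b≤c) = unrank-above Q (≤⇒≯ (unrank-monotone Q b≤c))

unrank-insert-above : ∀ Q → c < b → unrank (unrank Q b ∷ Q) c ≡ unrank Q c
unrank-insert-above Q c<b = unrank-below Q (unrank-increasing Q c<b)

unrank-swap : ∀ x y Q a → unrank (x ∷ y ∷ Q) a ≡ unrank (y ∷ x ∷ Q) a
unrank-swap x y Q a = pick-comm x y (unrank Q (suc (suc a))) (unrank-step Q a)

-- rank Q is strictly increasing on ℕ ∖ Q.  It is proved (below) from
-- unrank-rank for the same Q, while unrank-rank for y ∷ Q uses it for Q.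
rank-increasing : Unique Q → x ∉ Q → y ∉ Q → x < y → rank Q x < rank Q y

unrank-rank : Unique Q → x ∉ Q → unrank Q (rank Q x) ≡ x
unrank-rank {[]}    _           _              = refl
unrank-rank {y ∷ Q} {x} (y∉Q ∷ uQ) (x≢y ∷ x∉Q) with <-cmp y x
... | tri< y<x _ _ = begin
  unrank (y ∷ Q) (rank (y ∷ Q) x)              ≡⟨ cong (unrank (y ∷ Q)) (rank-above Q y<x) ⟩
  unrank (y ∷ Q) (pred (rank Q x))             ≡⟨ cong (λ z → unrank (z ∷ Q) _) (sym (unrank-rank uQ y∉Q)) ⟩
  unrank (unrank Q (rank Q y) ∷ Q) (pred (rank Q x))
    ≡⟨ unrank-insert-below Q (rank-increasing uQ y∉Q x∉Q y<x) ⟩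
  unrank Q (rank Q x)                          ≡⟨ unrank-rank uQ x∉Q ⟩
  x                                            ∎
... | tri≈ _ y≡x _ = contradiction (sym y≡x) x≢y
... | tri> _ _ x<y = begin
  unrank (y ∷ Q) (rank (y ∷ Q) x) ≡⟨ cong (unrank (y ∷ Q)) (rank-below Q (<⇒≯ x<y)) ⟩
  unrank (y ∷ Q) (rank Q x)       ≡⟨ unrank-below Q (subst (_< y) (sym (unrank-rank uQ x∉Q)) x<y) ⟩
  unrank Q (rank Q x)             ≡⟨ unrank-rank uQ x∉Q ⟩
  x                               ∎

rank-increasing {Q = Q} uQ x∉Q y∉Q x<y =
  unrank-reflects-< Q (subst₂ _<_ (sym (unrank-rank uQ x∉Q)) (sym (unrank-rank uQ y∉Q)) x<y)

encode : List ℕ → Word n → Vec ℕ n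
encode Q []      = []
encode Q (a ∷ w) = unrank Q a ∷ encode (unrank Q a ∷ Q) w

decode : List ℕ → Vec ℕ n → Word n
decode Q []      = []
decode Q (x ∷ v) = rank Q x ∷ decode (x ∷ Q) v

data Fresh : {n : ℕ} → List ℕ → Vec ℕ n → Set where
  []  : Fresh Q []
  _∷_ : x ∉ Q → Fresh (x ∷ Q) v → Fresh Q (x ∷ v)

decode-encode : ∀ Q (w : Word n) → decode Q (encode Q w) ≡ w
decode-encode Q []      = refl
decode-encode Q (a ∷ w) = cong₂ _∷_ (rank-unrank Q a) (decode-encode (unrank Q a ∷ Q) w)

encode-fresh : ∀ Q (w : Word n) → Fresh Q (encode Q w)
encode-fresh Q []      = []
encode-fresh Q (a ∷ w) = unrank-∉ Q a ∷ encode-fresh (unrank Q a ∷ Q) w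

encode-decode : Unique Q → Fresh Q v → encode Q (decode Q v) ≡ v
encode-decode uQ []                       = refl
encode-decode uQ (_∷_ {x = x} x∉Q fresh) rewrite unrank-rank uQ x∉Q =
  cong (x ∷_) (encode-decode (x∉Q ∷ uQ) fresh)

encode-cong : ∀ Q Q′ → (∀ a → unrank Q a ≡ unrank Q′ a) → (w : Word n) →
  encode Q w ≡ encode Q′ w
encode-cong Q Q′ Q≗Q′ []      = refl
encode-cong Q Q′ Q≗Q′ (a ∷ w) rewrite Q≗Q′ a =
  cong (unrank Q′ a ∷_)
    (encode-cong _ _ (λ b → cong₂ (pick (unrank Q′ a)) (Q≗Q′ b) (Q≗Q′ (suc b))) w)

swapAt : ℕ → Vec A n → Vec A n
swapAt zero    (x ∷ y ∷ v) = y ∷ x ∷ v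
swapAt zero    v           = v
swapAt (suc i) []          = []
swapAt (suc i) (x ∷ v)     = x ∷ swapAt i v

-- The key computation: for b ≤ a the encodings of b (a+1) and of (a+1) b use
-- the same two numbers, in swapped positions, and agree afterwards.
encode-adjacent : ∀ Q (w : Word n) → b ≤ a →
  encode Q (b ∷ a ∷ w) ≡ swapAt 0 (encode Q (suc a ∷ b ∷ w))
encode-adjacent {b = b} {a = a} Q w b≤a
  rewrite unrank-insert-below Q (s≤s b≤a) | unrank-insert-above Q (s≤s b≤a) =
  cong (λ t → unrank Q b ∷ unrank Q (suc a) ∷ t)
       (encode-cong _ _ (unrank-swap (unrank Q (suc a)) (unrank Q b) Q) w)

encode-step : ∀ Q i (w : Word n) → encode Q (step i w) ≡ swapAt i (encode Q w)
encode-step Q zero    []          = refl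
encode-step Q zero    (a ∷ [])    = refl
encode-step Q zero    (a ∷ b ∷ w) with b <ᵇ a | <ᵇ-reflects-< b a
encode-step Q zero (suc a ∷ b ∷ w) | true  | ofʸ (s≤s b≤a) = encode-adjacent Q w b≤a
encode-step Q zero    (a ∷ b ∷ w) | false | ofⁿ b≮a =
  cong (swapAt 0) (sym (encode-adjacent Q w (≮⇒≥ b≮a)))
encode-step Q (suc i) []          = refl
encode-step Q (suc i) (a ∷ w)     = cong (unrank Q a ∷_) (encode-step (unrank Q a ∷ Q) i w)

SD : Vec ℕ n → Set
SD = StrictlyDecreasing

-- For consecutive entries
-- a, b (both fresh), the decoded letters are rank Q a and rank (a ∷ Q) b, and
-- the second is smaller than the first exactly when b < a.
rank-insert-< : Unique Q → a ∉ Q → b ∉ Q → b < a → rank (a ∷ Q) b < rank Q a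
rank-insert-< {Q = Q} {a = a} uQ a∉Q b∉Q b<a =
  subst (_< rank Q a) (sym (rank-below Q (<⇒≯ b<a))) (rank-increasing uQ b∉Q a∉Q b<a)

rank-insert-<⁻¹ : Unique Q → a ∉ Q → b ∉ Q → rank (a ∷ Q) b < rank Q a → b < a
rank-insert-<⁻¹ {Q = Q} {a = a} {b = b} uQ a∉Q b∉Q r<r with <-cmp b a
... | tri< b<a _ _  = b<a
... | tri≈ _ refl _ = contradiction (subst (_< rank Q a) (rank-below Q (<-irrefl refl)) r<r) (<-irrefl refl)
... | tri> _ _ a<b  = contradiction (subst (_< rank Q a) (rank-above Q a<b) r<r)
                        (≤⇒≯ (<⇒≤pred (rank-increasing uQ a∉Q b∉Q a<b)))

decode-sd : Unique Q → Fresh Q v → SD v → SD (decode Q v)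
decode-sd _  []                       sd-[]          = sd-[]
decode-sd _  (_ ∷ [])                 sd-[x]         = sd-[x]
decode-sd uQ (a∉Q ∷ fresh@(b∉aQ ∷ _)) (sd-∷ b<a sd) =
  sd-∷ (rank-insert-< uQ a∉Q (All.tail b∉aQ) b<a) (decode-sd (a∉Q ∷ uQ) fresh sd)

decode-sd⁻¹ : Unique Q → Fresh Q v → SD (decode Q v) → SD v
decode-sd⁻¹ _  []                       sd-[]          = sd-[]
decode-sd⁻¹ _  (_ ∷ [])                 sd-[x]         = sd-[x]
decode-sd⁻¹ uQ (a∉Q ∷ fresh@(b∉aQ ∷ _)) (sd-∷ r<r sd) =
  sd-∷ (rank-insert-<⁻¹ uQ a∉Q (All.tail b∉aQ) r<r) (decode-sd⁻¹ (a∉Q ∷ uQ) fresh sd)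

fresh-∉ : Fresh Q v → ∀ k → lookup v k ∉ Q
fresh-∉ (x∉Q ∷ _)     zero    = x∉Q
fresh-∉ (_   ∷ fresh) (suc k) = All.tail (fresh-∉ fresh k)

fresh⇒injective : Fresh Q v → Injective _≡_ _≡_ (lookup v)
fresh⇒injective _             {zero}  {zero}  _   = refl
fresh⇒injective (_ ∷ fresh)   {zero}  {suc j} x≡y = contradiction (sym x≡y) (All.head (fresh-∉ fresh j))
fresh⇒injective (_ ∷ fresh)   {suc i} {zero}  y≡x = contradiction y≡x (All.head (fresh-∉ fresh i))
fresh⇒injective (_ ∷ fresh)   {suc i} {suc j} e   = cong suc (fresh⇒injective fresh e)

injective⇒fresh : (∀ k → lookup v k ∉ Q) → Injective _≡_ _≡_ (lookup v) → Fresh Q v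
injective⇒fresh {v = []}    _     _   = []
injective⇒fresh {v = x ∷ v} avoid inj =
  avoid zero ∷ injective⇒fresh (λ k → (λ e → Fin.0≢1+n (inj (sym e))) ∷ avoid (suc k))
                               (λ e → Fin.suc-injective (inj e))

-- Permutations act on vectors by moving entries: the entry at position k
-- goes to position σ k.  With σ ∘ₚ τ meaning "first σ, then τ" this is a
-- left action.
permute : Permutation′ n → Vec A n → Vec A n
permute σ v = tabulate (λ k → lookup v (σ ⟨$⟩ˡ k))

lookup-permute : ∀ (σ : Permutation′ n) (v : Vec A n) k →
  lookup (permute σ v) k ≡ lookup v (σ ⟨$⟩ˡ k)
lookup-permute σ v k = lookup∘tabulate _ k

permute-id : (v : Vec A n) → permute id v ≡ v
permute-id = tabulate∘lookup

permute-∘ : ∀ (σ τ : Permutation′ n) (v : Vec A n) →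
  permute τ (permute σ v) ≡ permute (σ ∘ₚ τ) v
permute-∘ σ τ v = tabulate-cong (λ k → lookup-permute σ v (τ ⟨$⟩ˡ k))

permute-cong : ∀ (σ τ : Permutation′ n) → σ ≈ τ → (v : Vec A n) →
  permute σ v ≡ permute τ v
permute-cong σ τ σ≈τ v = tabulate-cong (λ k → cong (lookup v) (inverse-cong k))
  where
  inverse-cong : ∀ k → σ ⟨$⟩ˡ k ≡ τ ⟨$⟩ˡ k
  inverse-cong k = begin
    σ ⟨$⟩ˡ k                     ≡⟨ cong (σ ⟨$⟩ˡ_) (sym (inverseʳ τ)) ⟩
    σ ⟨$⟩ˡ (τ ⟨$⟩ʳ (τ ⟨$⟩ˡ k))  ≡⟨ cong (σ ⟨$⟩ˡ_) (sym (σ≈τ (τ ⟨$⟩ˡ k))) ⟩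
    σ ⟨$⟩ˡ (σ ⟨$⟩ʳ (τ ⟨$⟩ˡ k))  ≡⟨ inverseˡ σ ⟩
    τ ⟨$⟩ˡ k                     ∎

permute-transpose-suc : ∀ (i j : Fin n) (x : A) v →
  permute (transpose (suc i) (suc j)) (x ∷ v) ≡ x ∷ permute (transpose i j) v
permute-transpose-suc i j x v =
  cong (x ∷_) (tabulate-cong (λ k → cong (lookup (x ∷ v)) (lift₀-transpose j i (suc k))))

-- The adjacent transposition (i, i+1) acts by swapAt i (stated for arbitrary
-- proofs of the bounds, so that the induction goes through).
permute-transpose-adjacent : ∀ i (q : i < n) (p : suc i < n) (v : Vec A n) →
  permute (transpose (fromℕ< q) (fromℕ< p)) v ≡ swapAt i v
permute-transpose-adjacent zero    (s≤s z≤n) (s≤s (s≤s z≤n)) (x ∷ y ∷ v) =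
  cong (λ t → y ∷ x ∷ t) (tabulate∘lookup v)
permute-transpose-adjacent (suc i) (s≤s q)   (s≤s p)         (x ∷ v)     =
  trans (permute-transpose-suc (fromℕ< q) (fromℕ< p) x v)
        (cong (x ∷_) (permute-transpose-adjacent i q p v))

permute-adjacent : ∀ i (p : suc i < n) (v : Vec A n) → permute (adjacent i p) v ≡ swapAt i v
permute-adjacent i p = permute-transpose-adjacent i (<-trans (n<1+n i) p) p

permute-injective : ∀ (σ : Permutation′ n) (v : Vec A n) →
  Injective _≡_ _≡_ (lookup v) → Injective _≡_ _≡_ (lookup (permute σ v))
permute-injective σ v inj {i} {j} e = begin
  i                        ≡⟨ sym (inverseʳ σ) ⟩
  σ ⟨$⟩ʳ (σ ⟨$⟩ˡ i)       ≡⟨ cong (σ ⟨$⟩ʳ_) (inj (trans (sym (lookup-permute σ v i))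
                                                  (trans e (lookup-permute σ v j)))) ⟩
  σ ⟨$⟩ʳ (σ ⟨$⟩ˡ j)       ≡⟨ inverseʳ σ ⟩
  j                        ∎

permute-fixed⇒id : ∀ (σ : Permutation′ n) (v : Vec A n) →
  Injective _≡_ _≡_ (lookup v) → permute σ v ≡ v → σ ≈ id
permute-fixed⇒id σ v inj σv≡v k = begin
  σ ⟨$⟩ʳ k                  ≡⟨ cong (σ ⟨$⟩ʳ_) (sym (inj (trans (sym (lookup-permute σ v k))
                                                          (cong (λ u → lookup u k) σv≡v)))) ⟩
  σ ⟨$⟩ʳ (σ ⟨$⟩ˡ k)        ≡⟨ inverseʳ σ ⟩
  k                         ∎

sd-head : SD (x ∷ v) → ∀ k → lookup v k < x
sd-head (sd-∷ y<x _)  zero    = y<x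
sd-head (sd-∷ y<x sd) (suc k) = <-trans (sd-head sd k) y<x

sd-lookup : SD v → ∀ {i j} → toℕ i < toℕ j → lookup v j < lookup v i
sd-lookup sd@(sd-∷ _ _) {zero}  {suc j} _         = sd-head sd j
sd-lookup (sd-∷ _ sd)    {suc i} {suc j} (s≤s i<j) = sd-lookup sd i<j

sd-lookup⁻¹ : SD v → ∀ {i j} → lookup v j < lookup v i → toℕ i < toℕ j
sd-lookup⁻¹ {v = v} sd {i} {j} vj<vi with <-cmp (toℕ i) (toℕ j)
... | tri< i<j _ _ = i<j
... | tri≈ _ i≡j _ = contradiction (cong (lookup v) (Fin.toℕ-injective i≡j)) (>⇒≢ vj<vi)
... | tri> _ _ j<i = contradiction (sd-lookup sd j<i) (<⇒≯ vj<vi)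

StrictlyIncreasing : (Fin n → Fin m) → Set
StrictlyIncreasing f = ∀ {i j} → toℕ i < toℕ j → toℕ (f i) < toℕ (f j)

increasing-inflationary : (f : Fin n → Fin m) → StrictlyIncreasing f → ∀ k → toℕ k ≤ toℕ (f k)
increasing-inflationary f inc zero    = z≤n
increasing-inflationary f inc (suc k) =
  ≤-<-trans (increasing-inflationary (f ∘ inject₁) inc′ k)
            (inc (s≤s (≤-reflexive (Fin.toℕ-inject₁ k))))
  where
  inc′ : StrictlyIncreasing (f ∘ inject₁)
  inc′ {i} {j} i<j = inc (subst₂ _<_ (sym (Fin.toℕ-inject₁ i)) (sym (Fin.toℕ-inject₁ j)) i<j)

-- The only strictly increasing permutation is the identity: both it and its
-- inverse are inflationary.
increasing-permutation : (π : Permutation′ n) → StrictlyIncreasing (π ⟨$⟩ʳ_) → ∀ k → π ⟨$⟩ʳ k ≡ k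
increasing-permutation π inc k =
  Fin.toℕ-injective (≤-antisym π-deflationary (increasing-inflationary _ inc k))
  where
  reflects : ∀ {i j} → toℕ (π ⟨$⟩ʳ i) < toℕ (π ⟨$⟩ʳ j) → toℕ i < toℕ j
  reflects {i} {j} πi<πj with <-cmp (toℕ i) (toℕ j)
  ... | tri< i<j _ _ = i<j
  ... | tri≈ _ i≡j _ = contradiction (cong (λ l → toℕ (π ⟨$⟩ʳ l)) (Fin.toℕ-injective i≡j)) (<⇒≢ πi<πj)
  ... | tri> _ _ j<i = contradiction (inc j<i) (<⇒≯ πi<πj)
  inc⁻¹ : StrictlyIncreasing (π ⟨$⟩ˡ_)
  inc⁻¹ i<j = reflects (subst₂ (λ a b → toℕ a < toℕ b) (sym (inverseʳ π)) (sym (inverseʳ π)) i<j)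
  π-deflationary : toℕ (π ⟨$⟩ʳ k) ≤ toℕ k
  π-deflationary = subst (λ l → toℕ (π ⟨$⟩ʳ k) ≤ toℕ l) (inverseˡ π)
                        (increasing-inflationary _ inc⁻¹ (π ⟨$⟩ʳ k))

permute-sd-unique : ∀ (σ τ : Permutation′ n) v → SD (permute σ v) → SD (permute τ v) →
  permute τ v ≡ permute σ v
permute-sd-unique σ τ v sdσ sdτ = tabulate-cong (λ k → cong (lookup v) (τ⁻¹≡σ⁻¹ k))
  where
  -- π sends a position of the τ-arrangement to the position of the same entry
  -- in the σ-arrangement; it is strictly increasing, hence the identity.
  π : Permutation′ _
  π = flip τ ∘ₚ σ
  same-entry : ∀ k → lookup (permute τ v) k ≡ lookup (permute σ v) (π ⟨$⟩ʳ k)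
  same-entry k = begin
    lookup (permute τ v) k                   ≡⟨ lookup-permute τ v k ⟩
    lookup v (τ ⟨$⟩ˡ k)                      ≡⟨ cong (lookup v) (sym (inverseˡ σ)) ⟩
    lookup v (σ ⟨$⟩ˡ (π ⟨$⟩ʳ k))            ≡⟨ sym (lookup-permute σ v (π ⟨$⟩ʳ k)) ⟩
    lookup (permute σ v) (π ⟨$⟩ʳ k)         ∎
  π-increasing : StrictlyIncreasing (π ⟨$⟩ʳ_)
  π-increasing {i} {j} i<j =
    sd-lookup⁻¹ sdσ (subst₂ _<_ (same-entry j) (same-entry i) (sd-lookup sdτ i<j))
  τ⁻¹≡σ⁻¹ : ∀ k → τ ⟨$⟩ˡ k ≡ σ ⟨$⟩ˡ k
  τ⁻¹≡σ⁻¹ k = trans (sym (inverseˡ σ)) (cong (σ ⟨$⟩ˡ_) (increasing-permutation π π-increasing k))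

argmax : (v : Vec ℕ (suc n)) → Σ[ j ∈ Fin (suc n) ] (∀ k → lookup v k ≤ lookup v j)
argmax (x ∷ [])    = zero , λ { zero → ≤-refl }
argmax (x ∷ y ∷ v) with argmax (y ∷ v)
... | j , max with lookup (y ∷ v) j ≤? x
...   | yes m≤x = zero  , λ { zero → ≤-refl ; (suc k) → ≤-trans (max k) m≤x }
...   | no  m≰x = suc j , λ { zero → <⇒≤ (≰⇒> m≰x) ; (suc k) → max k }

sd-cons : (∀ k → lookup v k < x) → SD v → SD (x ∷ v)
sd-cons {v = []}    _     _  = sd-[x]
sd-cons {v = y ∷ v} below sd = sd-∷ (below zero) sd

transpose-head : ∀ (j : Fin (suc n)) → transpose zero j ⟨$⟩ˡ zero ≡ j
transpose-head zero    = refl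
transpose-head (suc j) = refl

-- Every vector with distinct entries has a strictly decreasing rearrangement:
-- move a largest entry to the front and rearrange the rest recursively.
sort : (v : Vec ℕ n) → Injective _≡_ _≡_ (lookup v) → Σ[ σ ∈ Permutation′ n ] SD (permute σ v)
sort {zero}  []  _   = id , sd-[]
sort {suc n} v   inj = T ∘ₚ lift₀ σ , subst SD (permute-∘ T (lift₀ σ) v) (sd-cons below sd)
  where
  j : Fin (suc n)
  j = proj₁ (argmax v)
  T : Permutation′ (suc n)
  T = transpose zero j
  u : Vec ℕ (suc n)
  u = permute T v
  u-injective : Injective _≡_ _≡_ (lookup u)
  u-injective = permute-injective T v inj
  u-max : ∀ k → lookup u k ≤ lookup u zero
  u-max k = subst₂ _≤_ (sym (lookup-permute T v k))
              (sym (trans (lookup-permute T v zero) (cong (lookup v) (transpose-head j))))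
              (proj₂ (argmax v) _)
  rest : Σ[ σ ∈ Permutation′ n ] SD (permute σ (tail u))
  rest = sort (tail u) (λ e → Fin.suc-injective (u-injective e))
  σ : Permutation′ n
  σ = proj₁ rest
  sd : SD (permute σ (tail u))
  sd = proj₂ rest
  below : ∀ k → lookup (permute σ (tail u)) k < lookup u zero
  below k = subst (_< lookup u zero) (sym (lookup-permute σ (tail u) k))
              (≤∧≢⇒< (u-max (suc (σ ⟨$⟩ˡ k))) (λ e → Fin.0≢1+n (sym (u-injective e))))

code : Word n → Vec ℕ n
code = encode []

act : Permutation′ n → Word n → Word n
act σ w = decode [] (permute σ (code w))

code-injective : (w : Word n) → Injective _≡_ _≡_ (lookup (code w))
code-injective w = fresh⇒injective (encode-fresh [] w)

permute-code-fresh : ∀ (σ : Permutation′ n) w → Fresh [] (permute σ (code w))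
permute-code-fresh σ w =
  injective⇒fresh (λ _ → []) (permute-injective σ (code w) (code-injective w))

code-act : ∀ (σ : Permutation′ n) w → code (act σ w) ≡ permute σ (code w)
code-act σ w = encode-decode [] (permute-code-fresh σ w)

act-cong : ∀ (σ τ : Permutation′ n) → σ ≈ τ → ∀ w → act σ w ≡ act τ w
act-cong σ τ σ≈τ w = cong (decode []) (permute-cong σ τ σ≈τ (code w))

act-id : (w : Word n) → act id w ≡ w
act-id w = trans (cong (decode []) (permute-id (code w))) (decode-encode [] w)

act-∘ : ∀ (σ τ : Permutation′ n) w → act (σ ∘ₚ τ) w ≡ act τ (act σ w)
act-∘ σ τ w = begin
  decode [] (permute (σ ∘ₚ τ) (code w))      ≡⟨ cong (decode []) (sym (permute-∘ σ τ (code w))) ⟩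
  decode [] (permute τ (permute σ (code w))) ≡⟨ cong (decode [] ∘ permute τ) (sym (code-act σ w)) ⟩
  decode [] (permute τ (code (act σ w)))     ∎

act-adjacent : ∀ i (p : suc i < n) w → act (adjacent i p) w ≡ step i w
act-adjacent i p w = begin
  decode [] (permute (adjacent i p) (code w)) ≡⟨ cong (decode []) (permute-adjacent i p (code w)) ⟩
  decode [] (swapAt i (code w))               ≡⟨ cong (decode []) (sym (encode-step [] i w)) ⟩
  decode [] (code (step i w))                 ≡⟨ decode-encode [] (step i w) ⟩
  step i w                                    ∎

-- Freeness: a permutation fixing w fixes the distinct entries of code w.
act-free : ∀ (σ : Permutation′ n) w → act σ w ≡ w → σ ≈ id
act-free σ w σw≡w =
  permute-fixed⇒id σ (code w) (code-injective w) (trans (sym (code-act σ w)) (cong code σw≡w))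

act-sd-representative : (w : Word n) → Σ[ σ ∈ Permutation′ n ]
  (SD (act σ w) × (∀ τ → SD (act τ w) → act τ w ≡ act σ w))
act-sd-representative w =
  let σ , sdσ = sort (code w) (code-injective w) in
  σ , decode-sd [] (permute-code-fresh σ w) sdσ ,
  λ τ sdτ → cong (decode [])
    (permute-sd-unique σ τ (code w) sdσ (decode-sd⁻¹ [] (permute-code-fresh τ w) sdτ))

proposition3p2 : (n : ℕ) →
    Σ (Permutation′ n → Word n → Word n) λ act →
      ((σ τ : Permutation′ n) → σ ≈ τ → (w : Word n) → act σ w ≡ act τ w)
      × ((w : Word n) → act id w ≡ w)
      × ((σ τ : Permutation′ n) (w : Word n) → act (σ ∘ₚ τ) w ≡ act τ (act σ w))
      × ((i : ℕ) (p : suc i < n) (w : Word n) → act (adjacent i p) w ≡ step i w)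
      × ((σ : Permutation′ n) (w : Word n) → act σ w ≡ w → σ ≈ id)
      × ((w : Word n) → Σ (Permutation′ n) λ σ →
          StrictlyDecreasing (act σ w)
          × ((τ : Permutation′ n) → StrictlyDecreasing (act τ w) → act τ w ≡ act σ w))
proposition3p2 n = act , act-cong , act-id , act-∘ , act-adjacent , act-free , act-sd-representative
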